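{- Let $\mathcal R$ be a TRS, let $\mathcal P$ be a set of weak dependency pairs or weak innermost dependency pairs of $\mathcal R$ (i.e. $\mathcal P\subseteq\mathrm{WDP}(\mathcal R)$ or $\mathcal P\subseteq\mathrm{WIDP}(\mathcal R)$), and let $(t_i)_{i=0,1,\dots}$ be a finite or infinite sequence of terms with $t_i\to_{\mathcal P\cup\mathcal R}t_{i+1}$ for all consecutive indices. If $t_0\in\mathcal T_{\mathsf b}^\sharp$, then $t_i\to_{\mathcal P\cup\mathcal U(\mathcal P)}t_{i+1}$ for all consecutive indices.
   Context: $\mathcal R$ is a TRS over finite signature $\mathcal F$ and variables $\mathcal V$; defined symbols $\mathcal D$ are roots of left-hand sides, constructors $\mathcal C=\mathcal F\setminus\mathcal D$. Basic terms: $f(t_1,\dots,t_n)$ with $f\in\mathcal D$ and $t_i\in\mathcal T(\mathcal C,\mathcal V)$; $\mathcal T_{\mathsf b}^\sharp=\{t^\sharp\mid t\text{ basic}\}$, where $t^\sharp=t$ for a variable and $t^\sharp=f^\sharp(t_1,\dots,t_n)$ for $t=f(t_1,\dots,t_n)$ with $f^\sharp$ fresh. For a set $X$, every term is uniquely $C[u_1,\dots,u_n]$ with $C$ an $n$-hole context without elements of $X$ and each $u_i$ rooted in $X$; $\mathrm{COM}(u_1)=u_1$, $\mathrm{COM}(u_1,\dots,u_n)=c(u_1,\dots,u_n)$ ($n\neq1$, $c$ a fresh compound symbol). $\mathrm{WDP}(\mathcal R)$: rules $l^\sharp\to\mathrm{COM}(u_1^\sharp,\dots,u_n^\sharp)$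 for $l\to r\in\mathcal R$, $r=C[u_1,\dots,u_n]$ w.r.t. $X=\mathcal D\cup\mathcal V$; $\mathrm{WIDP}(\mathcal R)$ likewise with $X=\mathcal D$. Usable rules: $f\rhd g$ if some $l\to r\in\mathcal R$ with root of $l$ equal to $f$ has $g\in\mathcal D$ occurring in $r$; $\mathcal U(t)$ = rules of $\mathcal R$ whose left-hand side has root $g$ with $f\rhd^*g$ for some symbol $f$ occurring in $t$; $\mathcal U(\mathcal P)=\bigcup_{l\to r\in\mathcal P}\mathcal U(r)$. -}

module Defs where

open import Data.Nat using (ℕ; zero; suc; _<_)
open import Data.Fin using (Fin)
open import Data.Vec using (Vec; []; _∷_; lookup; _[_]≔_; fromList)
open import Data.Vec.Relation.Unary.All using (All)
open import Data.List using (List; []; _∷_; _++_; length; map)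
open import Data.Product using (Σ; ∃; _×_; _,_; proj₁; proj₂)
open import Data.Sum using (_⊎_)
open import Data.Maybe using (Maybe; just; nothing)
open import Data.Unit using (⊤)
open import Relation.Nullary using (¬_)
open import Relation.Binary.PropositionalEquality using (_≡_)
open import Relation.Binary.Construct.Closure.ReflexiveTransitive using (Star)

module Terms (S : Set) (ar : S → ℕ) where

  data Term : Set where
    var : ℕ → Term
    app : (f : S) → Vec Term (ar f) → Term

  Subst : Set
  Subst = ℕ → Term

  mutual
    _⟨_⟩ : Term → Subst → Term
    var x ⟨ σ ⟩ = σ x
    app f ts ⟨ σ ⟩ = app f (ts ⟨ σ ⟩*)

    _⟨_⟩* : ∀ {k} → Vec Term k → Subst → Vec Term k
    [] ⟨ σ ⟩* = []
    (t ∷ ts) ⟨ σ ⟩* = (t ⟨ σ ⟩) ∷ (ts ⟨ σ ⟩*)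

  Rule : Set
  Rule = Term × Term

  RuleSet : Set₁
  RuleSet = Rule → Set

  _∪_ : RuleSet → RuleSet → RuleSet
  (P ∪ Q) ρ = P ρ ⊎ Q ρ

  _⊆_ : RuleSet → RuleSet → Set
  P ⊆ Q = ∀ ρ → P ρ → Q ρ

  data Occurs (f : S) : Term → Set where
    here  : (ts : Vec Term (ar f)) → Occurs f (app f ts)
    there : ∀ {g} (ts : Vec Term (ar g)) (i : Fin (ar g)) →
            Occurs f (lookup ts i) → Occurs f (app g ts)

  data VarOcc (x : ℕ) : Term → Set where
    here  : VarOcc x (var x)
    there : ∀ {g} (ts : Vec Term (ar g)) (i : Fin (ar g)) →
            VarOcc x (lookup ts i) → VarOcc x (app g ts)

  RootIs : S → Term → Set
  RootIs f t = Σ (Vec Term (ar f)) λ ts → t ≡ app f ts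

  IsVar : Term → Set
  IsVar t = Σ ℕ λ x → t ≡ var x

  data Step (R : RuleSet) : Term → Term → Set where
    root : ∀ {l r} → R (l , r) → (σ : Subst) → Step R (l ⟨ σ ⟩) (r ⟨ σ ⟩)
    ctx  : ∀ {f} (ts : Vec Term (ar f)) (i : Fin (ar f)) {u : Term} →
           Step R (lookup ts i) u → Step R (app f ts) (app f (ts [ i ]≔ u))

  -- Decomposition t = C[u₁,…,uₙ] where C contains no element of X and the
  -- uᵢ are rooted in X (X given as a predicate "t is rooted in X").
  mutual
    data MaxSub (X : Term → Set) : Term → List Term → Set where
      inX    : ∀ {t} → X t → MaxSub X t (t ∷ [])
      varNX  : ∀ {x} → ¬ X (var x) → MaxSub X (var x) []
      appNX  : ∀ {f} {ts : Vec Term (ar f)} {us} →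
               ¬ X (app f ts) → MaxSubs X ts us → MaxSub X (app f ts) us

    data MaxSubs (X : Term → Set) : ∀ {k} → Vec Term k → List Term → Set where
      []  : MaxSubs X [] []
      _∷_ : ∀ {k t us} {ts : Vec Term k} {vs} →
            MaxSub X t us → MaxSubs X ts vs → MaxSubs X (t ∷ ts) (us ++ vs)

record TRS {n : ℕ} (ar : Fin n → ℕ) : Set₁ where
  open Terms (Fin n) ar
  field
    rules    : RuleSet
    lhs-nvar : ∀ {l r} → rules (l , r) → ¬ IsVar l
    var-cond : ∀ {l r} → rules (l , r) → ∀ x → VarOcc x r → VarOcc x l

-- Extended signature: original symbols f, marked symbols f♯, and
-- compound symbols c of every arity k.
data ESym (n : ℕ) : Set where
  orig  : Fin n → ESym n
  sharp : Fin n → ESym n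
  com   : ℕ → ESym n

earity : ∀ {n} → (Fin n → ℕ) → ESym n → ℕ
earity ar (orig f)  = ar f
earity ar (sharp f) = ar f
earity ar (com k)   = k

module _ {n : ℕ} (ar : Fin n → ℕ) where

  private
    module F = Terms (Fin n) ar
    module E = Terms (ESym n) (earity ar)

  ETerm : Set
  ETerm = E.Term

  ERuleSet : Set₁
  ERuleSet = E.RuleSet

  mutual
    embed : F.Term → E.Term
    embed (F.var x)    = E.var x
    embed (F.app f ts) = E.app (orig f) (embed* ts)

    embed* : ∀ {k} → Vec F.Term k → Vec E.Term k
    embed* []       = []
    embed* (t ∷ ts) = embed t ∷ embed* ts

  _♯ : F.Term → E.Term
  F.var x ♯    = E.var x
  F.app f ts ♯ = E.app (sharp f) (embed* ts)

  COM : List E.Term → E.Term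
  COM []           = E.app (com 0) []
  COM (u ∷ [])     = u
  COM (u ∷ v ∷ us) = E.app (com (length (u ∷ v ∷ us))) (fromList (u ∷ v ∷ us))

  module _ (R : TRS ar) where
    open TRS R

    Defined : Fin n → Set
    Defined f = Σ F.Rule λ ρ → rules ρ × F.RootIs f (proj₁ ρ)

    ConstructorTerm : F.Term → Set
    ConstructorTerm t = ∀ f → F.Occurs f t → ¬ Defined f

    Basic : F.Term → Set
    Basic t = Σ (Fin n) λ f → Σ (Vec F.Term (ar f)) λ ts →
              t ≡ F.app f ts × Defined f × All ConstructorTerm ts

    BasicSharp : E.Term → Set
    BasicSharp s = Σ F.Term λ t → Basic t × s ≡ t ♯

    InDV : F.Term → Set
    InDV t = F.IsVar t ⊎ Σ (Fin n) λ f → Defined f × F.RootIs f t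

    InD : F.Term → Set
    InD t = Σ (Fin n) λ f → Defined f × F.RootIs f t

    DPs : (F.Term → Set) → E.RuleSet
    DPs X (l' , r') = Σ F.Rule λ ρ → rules ρ × Σ (List F.Term) λ us →
                      F.MaxSub X (proj₂ ρ) us ×
                      l' ≡ (proj₁ ρ) ♯ × r' ≡ COM (map _♯ us)

    WDP : E.RuleSet
    WDP = DPs InDV

    WIDP : E.RuleSet
    WIDP = DPs InD

    embedRules : E.RuleSet
    embedRules (l' , r') = Σ F.Rule λ ρ → rules ρ ×
                           l' ≡ embed (proj₁ ρ) × r' ≡ embed (proj₂ ρ)

    _▷_ : ESym n → ESym n → Set
    f ▷ g = Σ F.Rule λ ρ → rules ρ × E.RootIs f (embed (proj₁ ρ)) ×
            Σ (Fin n) λ g' → g ≡ orig g' × Defined g' × E.Occurs g (embed (proj₂ ρ))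

    U : E.Term → E.RuleSet
    U t (l' , r') = Σ F.Rule λ ρ → rules ρ ×
                    l' ≡ embed (proj₁ ρ) × r' ≡ embed (proj₂ ρ) ×
                    Σ (ESym n) λ g → E.RootIs g (embed (proj₁ ρ)) ×
                    Σ (ESym n) λ f → E.Occurs f t × Star _▷_ f g

    UP : E.RuleSet → E.RuleSet
    UP P ρ' = Σ E.Rule λ π → P π × U (proj₂ π) ρ'

  _⊢_⟶_ : E.RuleSet → E.Term → E.Term → Set
  P ⊢ s ⟶ t = E.Step P s t

  _∪ᴱ_ : E.RuleSet → E.RuleSet → E.RuleSet
  _∪ᴱ_ = E._∪_

  _⊆ᴱ_ : E.RuleSet → E.RuleSet → Set
  _⊆ᴱ_ = E._⊆_

-- index i is a valid step index (t_i → t_{i+1}) of a sequence t_0,t_1,…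
-- of length len: nothing = infinite, just m = the finite sequence t_0,…,t_m
ValidStep : Maybe ℕ → ℕ → Set
ValidStep nothing  i = ⊤
ValidStep (just m) i = i < m

-- Call a defined symbol g usable if g is reachable by ▷* from a symbol on the
-- right-hand side of some pair in 𝒫; 𝒰(𝒫) consists exactly of the rules whose
-- left-hand side is rooted in a usable symbol. The invariant is that every
-- defined symbol occurring in tᵢ is usable. It holds for t₀ ∈ 𝒯_b^♯, since the
-- arguments of a basic term are constructor terms. It is preserved by a step:
-- the symbols of r σ come from r or from σ, and σ only contributes symbols of
-- l σ because both the rules of ℛ and the weak (innermost) dependency pairs
-- satisfy the variable condition. Symbols of the right-hand side of a pair are
-- usable by definition, and those of the right-hand side of an ℛ-rule are
-- ▷-successors of its root, which is usable by the invariant; the latter also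
-- shows that the ℛ-rule itself belongs to 𝒰(𝒫).
module Submission where

open import Defs
open import Data.Nat using (ℕ; suc; zero)
open import Data.Nat.Properties using (<-trans; n<1+n)
open import Data.Fin using (Fin; _≟_) renaming (zero to fzero; suc to fsuc)
open import Data.Maybe using (Maybe; just; nothing)
open import Data.Sum using (_⊎_; inj₁; inj₂; [_,_])
open import Data.Product using (Σ; _×_; _,_; proj₁; proj₂)
open import Data.List using ([]; _∷_; map)
open import Data.List.Relation.Unary.Any using (Any; here; there)
open import Data.List.Relation.Unary.Any.Properties using (++⁻)
open import Data.Vec using (Vec; []; _∷_; lookup; _[_]≔_; fromList)
open import Data.Vec.Properties using (lookup∘update; lookup∘update′)
open import Data.Vec.Relation.Unary.All.Properties using (lookup⁺)
open import Data.Vec.Relation.Unary.Any.Properties using (fromList⁻)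
open import Data.Vec.Membership.Propositional using (lose)
open import Data.Vec.Membership.Propositional.Properties using (∈-lookup)
open import Data.Empty using (⊥-elim)
open import Data.Unit using (⊤; tt)
open import Relation.Nullary using (yes; no)
open import Relation.Binary.PropositionalEquality using (_≡_; refl; subst; sym)
open import Relation.Binary.Construct.Closure.ReflexiveTransitive using (Star; ε; _◅_; _◅◅_)

ValidStep-pred : ∀ len i → ValidStep len (suc i) → ValidStep len i
ValidStep-pred nothing  i _ = tt
ValidStep-pred (just m) i v = <-trans (n<1+n i) v

module _ {A : Set} {_⟶_ _⟶′_ : A → A → Set} (Inv : A → Set)
         (transfer : ∀ {s t} → Inv s → s ⟶ t → s ⟶′ t × Inv t) where

  sequence-transfer : (len : Maybe ℕ) (t : ℕ → A) →
                      (∀ i → ValidStep len i → t i ⟶ t (suc i)) → Inv (t 0) →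
                      ∀ i → ValidStep len i → t i ⟶′ t (suc i)
  sequence-transfer len t steps inv₀ i v = proj₁ (transfer (invariant i v) (steps i v))
    where
    invariant : ∀ i → ValidStep len i → Inv (t i)
    invariant zero    _ = inv₀
    invariant (suc i) v = proj₂ (transfer (invariant i v′) (steps i v′))
      where
      v′ : ValidStep len i
      v′ = ValidStep-pred len i v

module TermProperties (S : Set) (ar : S → ℕ) where
  open Terms S ar

  lookup-⟨⟩* : ∀ {k} (ts : Vec Term k) σ i → lookup (ts ⟨ σ ⟩*) i ≡ lookup ts i ⟨ σ ⟩
  lookup-⟨⟩* (t ∷ ts) σ fzero    = refl
  lookup-⟨⟩* (t ∷ ts) σ (fsuc i) = lookup-⟨⟩* ts σ i

  mutual
    Occurs-⟨⟩⁻ : ∀ {f} t σ → Occurs f (t ⟨ σ ⟩) →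
                 Occurs f t ⊎ Σ ℕ λ x → VarOcc x t × Occurs f (σ x)
    Occurs-⟨⟩⁻ (var x)    σ o               = inj₂ (x , here , o)
    Occurs-⟨⟩⁻ (app g ts) σ (here _)        = inj₁ (here ts)
    Occurs-⟨⟩⁻ (app g ts) σ (there _ i o) with Occurs-⟨⟩*⁻ ts σ i o
    ... | inj₁ o′           = inj₁ (there ts i o′)
    ... | inj₂ (x , v , o′) = inj₂ (x , there ts i v , o′)

    Occurs-⟨⟩*⁻ : ∀ {f k} (ts : Vec Term k) σ i → Occurs f (lookup (ts ⟨ σ ⟩*) i) →
                  Occurs f (lookup ts i) ⊎ Σ ℕ λ x → VarOcc x (lookup ts i) × Occurs f (σ x)
    Occurs-⟨⟩*⁻ (t ∷ ts) σ fzero    o = Occurs-⟨⟩⁻ t σ o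
    Occurs-⟨⟩*⁻ (t ∷ ts) σ (fsuc i) o = Occurs-⟨⟩*⁻ ts σ i o

  Occurs-⟨⟩⁺ : ∀ {f x t} σ → VarOcc x t → Occurs f (σ x) → Occurs f (t ⟨ σ ⟩)
  Occurs-⟨⟩⁺ σ here             o = o
  Occurs-⟨⟩⁺ σ (there ts i v) o =
    there (ts ⟨ σ ⟩*) i (subst (Occurs _) (sym (lookup-⟨⟩* ts σ i)) (Occurs-⟨⟩⁺ σ v o))

  Occurs-update⁻ : ∀ {f g} (ts : Vec Term (ar g)) i u →
                   Occurs f (app g (ts [ i ]≔ u)) → Occurs f (app g ts) ⊎ Occurs f u
  Occurs-update⁻ ts i u (here _)        = inj₁ (here ts)
  Occurs-update⁻ ts i u (there _ j o) with j ≟ i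
  ... | yes refl = inj₂ (subst (Occurs _) (lookup∘update j ts u) o)
  ... | no j≢i   = inj₁ (there ts j (subst (Occurs _) (lookup∘update′ j≢i ts u) o))

  VarCondition : Rule → Set
  VarCondition (l , r) = ∀ {x} → VarOcc x r → VarOcc x l

  module _ (Q : S → Set) where

    AllSymbols : Term → Set
    AllSymbols t = ∀ f → Occurs f t → Q f

    AllSymbols-instance : ∀ {l r} → VarCondition (l , r) → ∀ σ →
                          AllSymbols (l ⟨ σ ⟩) → AllSymbols r → AllSymbols (r ⟨ σ ⟩)
    AllSymbols-instance {r = r} vc σ qlσ qr f o with Occurs-⟨⟩⁻ r σ o
    ... | inj₁ o′           = qr f o′
    ... | inj₂ (x , v , o′) = qlσ f (Occurs-⟨⟩⁺ σ (vc v) o′)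

    Step-transfer : ∀ {ℛ ℛ′ : RuleSet} →
                    (∀ {l r} → ℛ (l , r) → ∀ σ → AllSymbols (l ⟨ σ ⟩) →
                     ℛ′ (l , r) × AllSymbols (r ⟨ σ ⟩)) →
                    ∀ {s t} → AllSymbols s → Step ℛ s t → Step ℛ′ s t × AllSymbols t
    Step-transfer root-transfer qs (root ρ σ) with root-transfer ρ σ qs
    ... | ρ′ , qt = root ρ′ σ , qt
    Step-transfer root-transfer qs (ctx ts i {u} st)
      with Step-transfer root-transfer (λ f o → qs f (there ts i o)) st
    ... | st′ , qu = ctx ts i st′ , λ f o → [ qs f , qu f ] (Occurs-update⁻ ts i u o)

module _ {n : ℕ} (ar : Fin n → ℕ) where
  private
    module F = Terms (Fin n) ar
    module E = Terms (ESym n) (earity ar)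

  lookup-embed* : ∀ {k} (ts : Vec F.Term k) i → lookup (embed* ar ts) i ≡ embed ar (lookup ts i)
  lookup-embed* (t ∷ ts) fzero    = refl
  lookup-embed* (t ∷ ts) (fsuc i) = lookup-embed* ts i

  mutual
    VarOcc-embed⁻ : ∀ {x} t → E.VarOcc x (embed ar t) → F.VarOcc x t
    VarOcc-embed⁻ (F.var y)    E.here          = F.here
    VarOcc-embed⁻ (F.app f ts) (E.there _ i v) = F.there ts i (VarOcc-embed*⁻ ts i v)

    VarOcc-embed*⁻ : ∀ {x k} (ts : Vec F.Term k) i →
                     E.VarOcc x (lookup (embed* ar ts) i) → F.VarOcc x (lookup ts i)
    VarOcc-embed*⁻ (t ∷ ts) fzero    v = VarOcc-embed⁻ t v
    VarOcc-embed*⁻ (t ∷ ts) (fsuc i) v = VarOcc-embed*⁻ ts i v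

  VarOcc-embed⁺ : ∀ {x t} → F.VarOcc x t → E.VarOcc x (embed ar t)
  VarOcc-embed⁺ F.here = E.here
  VarOcc-embed⁺ (F.there ts i v) =
    E.there (embed* ar ts) i (subst (E.VarOcc _) (sym (lookup-embed* ts i)) (VarOcc-embed⁺ v))

  VarOcc-♯⁻ : ∀ {x} t → E.VarOcc x (_♯ ar t) → F.VarOcc x t
  VarOcc-♯⁻ (F.var y)    E.here          = F.here
  VarOcc-♯⁻ (F.app f ts) (E.there _ i v) = F.there ts i (VarOcc-embed*⁻ ts i v)

  VarOcc-♯⁺ : ∀ {x t} → F.VarOcc x t → E.VarOcc x (_♯ ar t)
  VarOcc-♯⁺ F.here = E.here
  VarOcc-♯⁺ (F.there ts i v) =
    E.there (embed* ar ts) i (subst (E.VarOcc _) (sym (lookup-embed* ts i)) (VarOcc-embed⁺ v))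

  mutual
    Occurs-embed⁻ : ∀ {g} t → E.Occurs (orig g) (embed ar t) → F.Occurs g t
    Occurs-embed⁻ (F.var y)    ()
    Occurs-embed⁻ (F.app f ts) (E.here _)      = F.here ts
    Occurs-embed⁻ (F.app f ts) (E.there _ i o) = F.there ts i (Occurs-embed*⁻ ts i o)

    Occurs-embed*⁻ : ∀ {g k} (ts : Vec F.Term k) i →
                     E.Occurs (orig g) (lookup (embed* ar ts) i) → F.Occurs g (lookup ts i)
    Occurs-embed*⁻ (t ∷ ts) fzero    o = Occurs-embed⁻ t o
    Occurs-embed*⁻ (t ∷ ts) (fsuc i) o = Occurs-embed*⁻ ts i o

  VarOcc-COM⁻ : ∀ {x} us → E.VarOcc x (COM ar us) → Any (E.VarOcc x) us
  VarOcc-COM⁻ []           (E.there _ () _)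
  VarOcc-COM⁻ (u ∷ [])     v               = here v
  VarOcc-COM⁻ (u ∷ w ∷ us) (E.there _ i v) = fromList⁻ (lose (∈-lookup i (fromList (u ∷ w ∷ us))) v)

  VarOcc-map♯⁻ : ∀ {x} us → Any (E.VarOcc x) (map (_♯ ar) us) → Any (F.VarOcc x) us
  VarOcc-map♯⁻ (u ∷ us) (here v)  = here (VarOcc-♯⁻ u v)
  VarOcc-map♯⁻ (u ∷ us) (there a) = there (VarOcc-map♯⁻ us a)

  mutual
    VarOcc-MaxSub⁻ : ∀ {X x t us} → F.MaxSub X t us → Any (F.VarOcc x) us → F.VarOcc x t
    VarOcc-MaxSub⁻ (F.inX _)   (here v) = v
    VarOcc-MaxSub⁻ (F.varNX _) ()
    VarOcc-MaxSub⁻ (F.appNX {ts = ts} _ ms) a with VarOcc-MaxSubs⁻ ms a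
    ... | i , v = F.there ts i v

    VarOcc-MaxSubs⁻ : ∀ {X x k us} {ts : Vec F.Term k} → F.MaxSubs X ts us →
                      Any (F.VarOcc x) us → Σ (Fin k) λ i → F.VarOcc x (lookup ts i)
    VarOcc-MaxSubs⁻ F.[] ()
    VarOcc-MaxSubs⁻ (F._∷_ {us = us} m ms) a with ++⁻ us a
    ... | inj₁ a′ = fzero , VarOcc-MaxSub⁻ m a′
    ... | inj₂ a′ with VarOcc-MaxSubs⁻ ms a′
    ... | i , v = fsuc i , v

  module _ (R : TRS ar) where
    open TRS R
    open TermProperties (ESym n) (earity ar) using (VarCondition)

    embedRules-VarCondition : ∀ {ρ} → embedRules ar R ρ → VarCondition ρ
    embedRules-VarCondition ((l , r) , ρ∈R , refl , refl) v =
      VarOcc-embed⁺ (var-cond ρ∈R _ (VarOcc-embed⁻ r v))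

    DPs-VarCondition : ∀ X {ρ} → DPs ar R X ρ → VarCondition ρ
    DPs-VarCondition X ((l , r) , ρ∈R , us , ms , refl , refl) v =
      VarOcc-♯⁺ (var-cond ρ∈R _ (VarOcc-MaxSub⁻ ms (VarOcc-map♯⁻ us (VarOcc-COM⁻ (map (_♯ ar) us) v))))

    weak-DPs-VarCondition : ∀ {P} → (_⊆ᴱ_ ar P (WDP ar R) ⊎ _⊆ᴱ_ ar P (WIDP ar R)) →
                            ∀ {ρ} → P ρ → VarCondition ρ
    weak-DPs-VarCondition (inj₁ P⊆WDP)  π∈P = DPs-VarCondition (InDV ar R) (P⊆WDP _ π∈P)
    weak-DPs-VarCondition (inj₂ P⊆WIDP) π∈P = DPs-VarCondition (InD ar R) (P⊆WIDP _ π∈P)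

module UsableSymbols {n : ℕ} (ar : Fin n → ℕ) (R : TRS ar) (P : ERuleSet ar) where
  private
    module F = Terms (Fin n) ar
    module E = Terms (ESym n) (earity ar)
  open TRS R
  open TermProperties (ESym n) (earity ar)

  Reachable : ESym n → Set
  Reachable g = Σ E.Rule λ π → P π × Σ (ESym n) λ f → E.Occurs f (proj₂ π) × Star (_▷_ ar R) f g

  Usable : ESym n → Set
  Usable (orig g) = Defined ar R g → Reachable (orig g)
  Usable _        = ⊤

  Reachable⇒Usable : ∀ {f} → Reachable f → Usable f
  Reachable⇒Usable {orig g}  r = λ _ → r
  Reachable⇒Usable {sharp g} r = tt
  Reachable⇒Usable {com k}   r = tt

  Reachable-▷ : ∀ {f g} → Reachable f → _▷_ ar R f g → Reachable g
  Reachable-▷ (π , π∈P , h , o , h▷*f) f▷g = π , π∈P , h , o , (h▷*f ◅◅ (f▷g ◅ ε))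

  Reachable⇒∈UP : ∀ {g ts r} → Reachable (orig g) → rules (F.app g ts , r) →
                  UP ar R P (embed ar (F.app g ts) , embed ar r)
  Reachable⇒∈UP (π , π∈P , f , o , f▷*g) ρ∈R =
    π , π∈P , (_ , ρ∈R , refl , refl , orig _ , (_ , refl) , f , o , f▷*g)

  BasicSharp⇒AllSymbols-Usable : ∀ {s} → BasicSharp ar R s → AllSymbols Usable s
  BasicSharp⇒AllSymbols-Usable (_ , (f , ts , refl , _ , ts-constructor) , refl) = usable
    where
    usable : AllSymbols Usable (E.app (sharp f) (embed* ar ts))
    usable (orig g)  (E.there _ i o) g∈𝒟 =
      ⊥-elim (lookup⁺ ts-constructor i g (Occurs-embed*⁻ ar ts i o) g∈𝒟)
    usable (sharp _) _ = tt
    usable (com _)   _ = tt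

  module _ (P-VarCondition : ∀ {ρ} → P ρ → VarCondition ρ) where

    root-transfer : ∀ {l r} → (_∪ᴱ_ ar P (embedRules ar R)) (l , r) → ∀ σ →
                    AllSymbols Usable (l E.⟨ σ ⟩) →
                    (_∪ᴱ_ ar P (UP ar R P)) (l , r) × AllSymbols Usable (r E.⟨ σ ⟩)
    root-transfer (inj₁ π∈P) σ usable-lσ =
      inj₁ π∈P , AllSymbols-instance Usable (P-VarCondition π∈P) σ usable-lσ
            (λ f o → Reachable⇒Usable (_ , π∈P , f , o , ε))
    root-transfer (inj₂ ((F.var y , r) , ρ∈R , refl , refl)) σ _ = ⊥-elim (lhs-nvar ρ∈R (y , refl))
    root-transfer (inj₂ ρ@((F.app g ts , r) , ρ∈R , refl , refl)) σ usable-lσ =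
      inj₂ (Reachable⇒∈UP g-reachable ρ∈R) ,
      AllSymbols-instance Usable (embedRules-VarCondition ar R ρ) σ usable-lσ usable-r
      where
      g-reachable : Reachable (orig g)
      g-reachable = usable-lσ (orig g) (E.here _) (_ , ρ∈R , (ts , refl))
      usable-r : AllSymbols Usable (embed ar r)
      usable-r (orig h)  oh h∈𝒟 =
        Reachable-▷ g-reachable (_ , ρ∈R , (embed* ar ts , refl) , h , refl , h∈𝒟 , oh)
      usable-r (sharp h) oh     = tt
      usable-r (com k)   oh     = tt

lemma33 : {n : ℕ} (ar : Fin n → ℕ) (R : TRS ar) (P : ERuleSet ar) →
          (_⊆ᴱ_ ar P (WDP ar R) ⊎ _⊆ᴱ_ ar P (WIDP ar R)) →
          (len : Maybe ℕ) (t : ℕ → ETerm ar) →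
          (∀ i → ValidStep len i →
            _⊢_⟶_ ar (_∪ᴱ_ ar P (embedRules ar R)) (t i) (t (suc i))) →
          BasicSharp ar R (t 0) →
          ∀ i → ValidStep len i →
            _⊢_⟶_ ar (_∪ᴱ_ ar P (UP ar R P)) (t i) (t (suc i))
lemma33 {n} ar R P P⊆DPs len t steps t₀-basic =
  sequence-transfer (AllSymbols Usable) step-transfer len t steps
                    (BasicSharp⇒AllSymbols-Usable t₀-basic)
  where
  open TermProperties (ESym n) (earity ar) using (AllSymbols; Step-transfer)
  open UsableSymbols ar R P

  step-transfer : ∀ {s u} → AllSymbols Usable s →
                  _⊢_⟶_ ar (_∪ᴱ_ ar P (embedRules ar R)) s u →
                  _⊢_⟶_ ar (_∪ᴱ_ ar P (UP ar R P)) s u × AllSymbols Usable u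
  step-transfer = Step-transfer Usable (root-transfer (weak-DPs-VarCondition ar R P⊆DPs))
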